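{- Let $(f_n(q))_{n\ge0}$ and $(g_n(q))_{n\ge0}$ be polynomials, and for $N\ge0$ let $F(q;N)=\sum_{n=0}^N f_n(q)(q;q)_n$ and $G(q;N)=\sum_{n=0}^N g_n(q)(q;q^2)_n$. Let $\zeta$ be a $k$th root of unity and $\ell\ge0$. (1) The values $\left(q\frac{d}{dq}\right)^{\ell}F(q;N)\big|_{q=\zeta}$ are independent of $N$ for all $N\ge(\ell+1)k-1$. (2) If $k$ is odd, the values $\left(q\frac{d}{dq}\right)^{\ell}G(q;N)\big|_{q=\zeta}$ are independent of $N$ for all $N$ with $2N\ge(2\ell+1)k$.
   Context: $(x;q)_n=(1-x)(1-xq)\cdots(1-xq^{n-1})$. -}

module Defs where

open import Level using (Level)
open import Algebra.Bundles using (CommutativeRing)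
open import Data.Nat using (ℕ; zero; suc)
open import Data.List using (List; []; _∷_)

-- Univariate polynomials over a commutative ring R, represented by their
-- coefficient lists: a₀ ∷ a₁ ∷ … ∷ aₘ ∷ [] stands for a₀ + a₁ q + … + aₘ qᵐ.
module Poly {c ℓ : Level} (R : CommutativeRing c ℓ) where
  open CommutativeRing R

  Polynomial : Set c
  Polynomial = List Carrier

  _·_ : ℕ → Carrier → Carrier
  zero  · a = 0#
  suc n · a = a + (n · a)

  _^_ : Carrier → ℕ → Carrier
  x ^ zero  = 1#
  x ^ suc n = x * (x ^ n)

  const : Carrier → Polynomial
  const a = a ∷ []

  qpow : ℕ → Polynomial
  qpow zero    = 1# ∷ []
  qpow (suc n) = 0# ∷ qpow n

  _⊕_ : Polynomial → Polynomial → Polynomial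
  []       ⊕ qs       = qs
  (p ∷ ps) ⊕ []       = p ∷ ps
  (p ∷ ps) ⊕ (q ∷ qs) = (p + q) ∷ (ps ⊕ qs)

  neg : Polynomial → Polynomial
  neg []       = []
  neg (p ∷ ps) = (- p) ∷ neg ps

  scale : Carrier → Polynomial → Polynomial
  scale a []       = []
  scale a (p ∷ ps) = (a * p) ∷ scale a ps

  _⊗_ : Polynomial → Polynomial → Polynomial
  []       ⊗ qs = []
  (p ∷ ps) ⊗ qs = scale p qs ⊕ (0# ∷ (ps ⊗ qs))

  eval : Polynomial → Carrier → Carrier
  eval []       x = 0#
  eval (p ∷ ps) x = p + x * eval ps x

  qD-from : ℕ → Polynomial → Polynomial
  qD-from i []       = []
  qD-from i (a ∷ as) = (i · a) ∷ qD-from (suc i) as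

  qD : Polynomial → Polynomial
  qD = qD-from 0

  qD^ : ℕ → Polynomial → Polynomial
  qD^ zero    p = p
  qD^ (suc n) p = qD (qD^ n p)

  one-minus-qpow : ℕ → Polynomial
  one-minus-qpow m = const 1# ⊕ neg (qpow m)

  qq-poch : ℕ → Polynomial
  qq-poch zero    = const 1#
  qq-poch (suc n) = qq-poch n ⊗ one-minus-qpow (suc n)

  qq2-poch : ℕ → Polynomial
  qq2-poch zero    = const 1#
  qq2-poch (suc n) = qq2-poch n ⊗ one-minus-qpow (suc (2 Data.Nat.* n))

  Fsum : (ℕ → Polynomial) → ℕ → Polynomial
  Fsum f zero    = f 0 ⊗ qq-poch 0
  Fsum f (suc N) = Fsum f N ⊕ (f (suc N) ⊗ qq-poch (suc N))

  Gsum : (ℕ → Polynomial) → ℕ → Polynomial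
  Gsum g zero    = g 0 ⊗ qq2-poch 0
  Gsum g (suc N) = Gsum g N ⊕ (g (suc N) ⊗ qq2-poch (suc N))

module Submission where

-- Fix ζ with ζ^k = 1.  Say a polynomial p vanishes to order m at ζ when
-- p, θp, …, θ^(m-1)p all vanish at ζ, where θ = q d/dq (qD of Defs).  Because θ is a
-- derivation, orders add under multiplication.  Each factor 1 - q^n with
-- k ∣ n vanishes at ζ, so a product of factors in which every k-th factor
-- vanishes at ζ has order at least j + 1 once it contains j + 1 such
-- factors.  Consequently in F(q;N) = Σ f_n (q;q)_n every summand with
-- n ≥ (ℓ+1)k has order > ℓ and contributes nothing to θ^ℓ F at ζ, and the
-- same holds for G(q;N) = Σ g_n (q;q²)_n when k is odd, because then the
-- factor 1 - q^(2n+1) vanishes at ζ exactly for n ≡ (k-1)/2 (mod k).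

open import Defs
open import Level using (Level)
open import Algebra.Bundles using (CommutativeRing)
open import Data.Nat as Nat using (ℕ; suc; _≤_)
open import Data.Product using (_×_; ∃)
open import Relation.Binary.PropositionalEquality using (_≡_)

open import Data.Nat using (zero; z≤n; _<_; s≤s; s≤s⁻¹; _≤′_; ≤′-refl; ≤′-step)
import Data.Nat.Properties as ℕₚ
open ℕₚ using (+-monoʳ-<; m<n+m; ≤-trans; n≤1+n; ≤⇒≤′; ≤′⇒≤; *-cancelˡ-≤)
open import Data.Nat.Tactic.RingSolver using (solve-∀)
open import Data.Product using (_,_)
open import Data.List using ([]; _∷_)
open import Data.Unit.Polymorphic using (⊤; tt)
import Relation.Binary.PropositionalEquality as ≡
import Algebra.Properties.Ring as RingProperties
import Algebra.Properties.Semiring.Mult as SemiringMultiples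
import Algebra.Properties.CommutativeMonoid.Mult as CommutativeMonoidMultiples
import Algebra.Properties.CommutativeSemigroup as CommutativeSemigroupProperties

-- For k = 2m+1, the factor 1 - q^(2n+1) of (q;q²) at n = m + j k is 1 - q^((2j+1) k).
odd-exponent : ∀ m j → suc (2 Nat.* (m Nat.+ j Nat.* suc (2 Nat.* m))) ≡ suc (2 Nat.* j) Nat.* suc (2 Nat.* m)
odd-exponent = solve-∀

odd-threshold : ∀ m l N → suc (2 Nat.* l) Nat.* suc (2 Nat.* m) ≤ 2 Nat.* N →
  m Nat.+ l Nat.* suc (2 Nat.* m) ≤ N
odd-threshold m l N le =
  *-cancelˡ-≤ 2 (≤-trans (n≤1+n _) (≡.subst (_≤ 2 Nat.* N) (≡.sym (odd-exponent m l)) le))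

module Theory {c ℓ' : Level} (R : CommutativeRing c ℓ') where
  open CommutativeRing R hiding (zero)
  open Poly R
  open RingProperties ring using (-0#≈0#; -‿+-comm; -‿distribʳ-*)
  open SemiringMultiples semiring
    using (×-congʳ; ×-congˡ; ×-homo-+; ×-assoc-*; ×-comm-*)
    renaming (_×_ to _×ᴿ_)
  open CommutativeMonoidMultiples +-commutativeMonoid using (×-distrib-+)
  open CommutativeSemigroupProperties +-commutativeSemigroup using (interchange)
  open CommutativeSemigroupProperties *-commutativeSemigroup using (x∙yz≈y∙xz)
  open import Relation.Binary.Reasoning.Setoid setoid

  ·≡×ᴿ : ∀ n a → n · a ≡ n ×ᴿ a
  ·≡×ᴿ zero    a = ≡.refl
  ·≡×ᴿ (suc n) a = ≡.cong (a +_) (·≡×ᴿ n a)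

  -- Multiples of zero vanish (needed for coefficients beyond the list end).
  ×ᴿ-zero : ∀ n → n ×ᴿ 0# ≈ 0#
  ×ᴿ-zero zero    = refl
  ×ᴿ-zero (suc n) = trans (+-identityˡ _) (×ᴿ-zero n)

  -- Coefficient lists with trailing zeros (or ≈-equal entries) denote the
  -- same polynomial, so equality of polynomials is coefficientwise.
  coeff : ℕ → Polynomial → Carrier
  coeff i       []       = 0#
  coeff zero    (a ∷ as) = a
  coeff (suc i) (a ∷ as) = coeff i as

  infix 4 _≋_
  _≋_ : Polynomial → Polynomial → Set ℓ'
  A ≋ B = ∀ i → coeff i A ≈ coeff i B

  coeff-⊕ : ∀ i A B → coeff i (A ⊕ B) ≈ coeff i A + coeff i B
  coeff-⊕ i       []       B        = sym (+-identityˡ _)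
  coeff-⊕ i       (a ∷ as) []       = sym (+-identityʳ _)
  coeff-⊕ zero    (a ∷ as) (b ∷ bs) = refl
  coeff-⊕ (suc i) (a ∷ as) (b ∷ bs) = coeff-⊕ i as bs

  coeff-scale : ∀ i a A → coeff i (scale a A) ≈ a * coeff i A
  coeff-scale i       a []       = sym (zeroʳ a)
  coeff-scale zero    a (p ∷ ps) = refl
  coeff-scale (suc i) a (p ∷ ps) = coeff-scale i a ps

  coeff-cons-⊗ : ∀ i a as B →
    coeff i ((a ∷ as) ⊗ B) ≈ a * coeff i B + coeff i (0# ∷ (as ⊗ B))
  coeff-cons-⊗ i a as B =
    trans (coeff-⊕ i (scale a B) (0# ∷ (as ⊗ B))) (+-congʳ (coeff-scale i a B))

  -- qD-from j is θ + j : it multiplies the i-th coefficient by j + i.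
  coeff-qD : ∀ j i A → coeff i (qD-from j A) ≈ (j Nat.+ i) ×ᴿ coeff i A
  coeff-qD j i       []       = sym (×ᴿ-zero (j Nat.+ i))
  coeff-qD j zero    (a ∷ as) =
    reflexive (≡.trans (·≡×ᴿ j a) (≡.cong (_×ᴿ a) (≡.sym (ℕₚ.+-identityʳ j))))
  coeff-qD j (suc i) (a ∷ as) =
    trans (coeff-qD (suc j) i as) (×-congˡ (≡.sym (ℕₚ.+-suc j i)))

  qD-cong : ∀ A B → A ≋ B → qD A ≋ qD B
  qD-cong A B A≋B i =
    trans (coeff-qD 0 i A) (trans (×-congʳ i (A≋B i)) (sym (coeff-qD 0 i B)))

  qD-⊕ : ∀ A B → qD (A ⊕ B) ≋ qD A ⊕ qD B
  qD-⊕ A B i = begin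
    coeff i (qD (A ⊕ B))            ≈⟨ coeff-qD 0 i (A ⊕ B) ⟩
    i ×ᴿ coeff i (A ⊕ B)            ≈⟨ ×-congʳ i (coeff-⊕ i A B) ⟩
    i ×ᴿ (coeff i A + coeff i B)    ≈⟨ ×-distrib-+ _ _ i ⟩
    i ×ᴿ coeff i A + i ×ᴿ coeff i B ≈⟨ +-cong (sym (coeff-qD 0 i A)) (sym (coeff-qD 0 i B)) ⟩
    coeff i (qD A) + coeff i (qD B) ≈⟨ sym (coeff-⊕ i (qD A) (qD B)) ⟩
    coeff i (qD A ⊕ qD B)           ∎

  qD^-⊕ : ∀ l A B → qD^ l (A ⊕ B) ≋ qD^ l A ⊕ qD^ l B
  qD^-⊕ zero    A B i = refl
  qD^-⊕ (suc l) A B i =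
    trans (qD-cong (qD^ l (A ⊕ B)) (qD^ l A ⊕ qD^ l B) (qD^-⊕ l A B) i) (qD-⊕ (qD^ l A) (qD^ l B) i)

  qD^-suc : ∀ n p → qD^ n (qD p) ≡ qD^ (suc n) p
  qD^-suc zero    p = ≡.refl
  qD^-suc (suc n) p = ≡.cong qD (qD^-suc n p)

  -- Leibniz rule for θ + j, coefficientwise, by induction on the first
  -- factor; the shifted tail uses the rule for θ + (j + 1).
  leibniz-coeff : ∀ j A B i →
    coeff i (qD-from j (A ⊗ B)) ≈ coeff i (qD-from j A ⊗ B) + coeff i (A ⊗ qD B)
  leibniz-coeff j [] B i = sym (+-identityˡ 0#)
  leibniz-coeff j (a ∷ as) B i = begin
    coeff i (qD-from j ((a ∷ as) ⊗ B))      ≈⟨ coeff-qD j i ((a ∷ as) ⊗ B) ⟩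
    (j Nat.+ i) ×ᴿ coeff i ((a ∷ as) ⊗ B)   ≈⟨ ×-congʳ (j Nat.+ i) (coeff-cons-⊗ i a as B) ⟩
    (j Nat.+ i) ×ᴿ (a * b + s)              ≈⟨ ×-distrib-+ (a * b) s (j Nat.+ i) ⟩
    (j Nat.+ i) ×ᴿ (a * b) + (j Nat.+ i) ×ᴿ s
      ≈⟨ +-cong (×-homo-+ (a * b) j i) (shifted i) ⟩
    (j ×ᴿ (a * b) + i ×ᴿ (a * b)) + (s₁ + s₂)
      ≈⟨ +-congʳ (+-cong (sym (×-assoc-* j a b)) (sym (×-comm-* i a b))) ⟩
    ((j ×ᴿ a) * b + a * (i ×ᴿ b)) + (s₁ + s₂) ≈⟨ interchange _ _ _ _ ⟩
    ((j ×ᴿ a) * b + s₁) + (a * (i ×ᴿ b) + s₂)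
      ≈⟨ +-cong (+-congʳ (*-congʳ (reflexive (≡.sym (·≡×ᴿ j a)))))
                (+-congʳ (*-congˡ (sym (coeff-qD 0 i B)))) ⟩
    ((j · a) * b + s₁) + (a * coeff i (qD B) + s₂)
      ≈⟨ +-cong (sym (coeff-cons-⊗ i (j · a) (qD-from (suc j) as) B))
                (sym (coeff-cons-⊗ i a as (qD B))) ⟩
    coeff i (qD-from j (a ∷ as) ⊗ B) + coeff i ((a ∷ as) ⊗ qD B) ∎
    where
      b  = coeff i B
      s  = coeff i (0# ∷ (as ⊗ B))
      s₁ = coeff i (0# ∷ (qD-from (suc j) as ⊗ B))
      s₂ = coeff i (0# ∷ (as ⊗ qD B))
      shifted : ∀ i → (j Nat.+ i) ×ᴿ coeff i (0# ∷ (as ⊗ B))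
        ≈ coeff i (0# ∷ (qD-from (suc j) as ⊗ B)) + coeff i (0# ∷ (as ⊗ qD B))
      shifted zero    = trans (×ᴿ-zero (j Nat.+ 0)) (sym (+-identityˡ 0#))
      shifted (suc i) = trans (×-congˡ (ℕₚ.+-suc j i))
        (trans (sym (coeff-qD (suc j) i (as ⊗ B))) (leibniz-coeff (suc j) as B i))

  leibniz : ∀ A B → qD (A ⊗ B) ≋ (qD A ⊗ B) ⊕ (A ⊗ qD B)
  leibniz A B i = trans (leibniz-coeff 0 A B i) (sym (coeff-⊕ i (qD A ⊗ B) (A ⊗ qD B)))

  module Evaluation (x : Carrier) where
    eval-zero : ∀ A → (∀ i → coeff i A ≈ 0#) → eval A x ≈ 0#
    eval-zero []       A≈0 = refl
    eval-zero (a ∷ as) A≈0 =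
      trans (+-cong (A≈0 0) (trans (*-congˡ (eval-zero as (λ i → A≈0 (suc i)))) (zeroʳ x)))
            (+-identityˡ 0#)

    eval-cong : ∀ A B → A ≋ B → eval A x ≈ eval B x
    eval-cong []       B        A≋B = sym (eval-zero B (λ i → sym (A≋B i)))
    eval-cong (a ∷ as) []       A≋B = eval-zero (a ∷ as) A≋B
    eval-cong (a ∷ as) (b ∷ bs) A≋B =
      +-cong (A≋B 0) (*-congˡ (eval-cong as bs (λ i → A≋B (suc i))))

    eval-⊕ : ∀ A B → eval (A ⊕ B) x ≈ eval A x + eval B x
    eval-⊕ []       B        = sym (+-identityˡ _)
    eval-⊕ (a ∷ as) []       = sym (+-identityʳ _)
    eval-⊕ (a ∷ as) (b ∷ bs) =
      trans (+-congˡ (trans (*-congˡ (eval-⊕ as bs)) (distribˡ x _ _))) (interchange a b _ _)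

    eval-scale : ∀ a A → eval (scale a A) x ≈ a * eval A x
    eval-scale a []       = sym (zeroʳ a)
    eval-scale a (p ∷ ps) =
      trans (+-congˡ (trans (*-congˡ (eval-scale a ps)) (x∙yz≈y∙xz x a _))) (sym (distribˡ a p _))

    eval-⊗ : ∀ A B → eval (A ⊗ B) x ≈ eval A x * eval B x
    eval-⊗ []       B = sym (zeroˡ _)
    eval-⊗ (a ∷ as) B = begin
      eval (scale a B ⊕ (0# ∷ (as ⊗ B))) x              ≈⟨ eval-⊕ (scale a B) (0# ∷ (as ⊗ B)) ⟩
      eval (scale a B) x + (0# + x * eval (as ⊗ B) x)   ≈⟨ +-cong (eval-scale a B) (+-identityˡ _) ⟩
      a * eB + x * eval (as ⊗ B) x                      ≈⟨ +-congˡ (*-congˡ (eval-⊗ as B)) ⟩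
      a * eB + x * (eval as x * eB)                     ≈⟨ +-congˡ (sym (*-assoc x _ eB)) ⟩
      a * eB + (x * eval as x) * eB                     ≈⟨ sym (distribʳ eB a _) ⟩
      (a + x * eval as x) * eB                          ∎
      where eB = eval B x

    eval-neg : ∀ A → eval (neg A) x ≈ - eval A x
    eval-neg []       = sym -0#≈0#
    eval-neg (p ∷ ps) =
      trans (+-congˡ (trans (*-congˡ (eval-neg ps)) (sym (-‿distribʳ-* x _)))) (-‿+-comm p _)

    eval-qpow : ∀ n → eval (qpow n) x ≈ x ^ n
    eval-qpow zero    = trans (+-congˡ (zeroʳ x)) (+-identityʳ 1#)
    eval-qpow (suc n) = trans (+-identityˡ _) (*-congˡ (eval-qpow n))

    eval-one-minus-qpow : ∀ n → x ^ n ≈ 1# → eval (one-minus-qpow n) x ≈ 0#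
    eval-one-minus-qpow n xⁿ≈1 = begin
      eval (const 1# ⊕ neg (qpow n)) x         ≈⟨ eval-⊕ (const 1#) (neg (qpow n)) ⟩
      (1# + x * 0#) + eval (neg (qpow n)) x
        ≈⟨ +-cong (trans (+-congˡ (zeroʳ x)) (+-identityʳ 1#))
                  (trans (eval-neg (qpow n)) (-‿cong (trans (eval-qpow n) xⁿ≈1))) ⟩
      1# + - 1#                                ≈⟨ -‿inverseʳ 1# ⟩
      0#                                       ∎

  open Evaluation public

  pow-+ : ∀ x m n → x ^ (m Nat.+ n) ≈ x ^ m * x ^ n
  pow-+ x zero    n = sym (*-identityˡ _)
  pow-+ x (suc m) n = trans (*-congˡ (pow-+ x m n)) (sym (*-assoc x _ _))

  root-pow : ∀ x k m → x ^ k ≈ 1# → x ^ (m Nat.* k) ≈ 1#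
  root-pow x k zero    xᵏ≈1 = refl
  root-pow x k (suc m) xᵏ≈1 =
    trans (pow-+ x k (m Nat.* k)) (trans (*-cong xᵏ≈1 (root-pow x k m xᵏ≈1)) (*-identityˡ 1#))

  module Vanishing (ζ : Carrier) where

    Vanishes : ℕ → Polynomial → Set ℓ'
    Vanishes zero    p = ⊤
    Vanishes (suc m) p = eval p ζ ≈ 0# × Vanishes m (qD p)

    vanishes-cong : ∀ m A B → A ≋ B → Vanishes m A → Vanishes m B
    vanishes-cong zero    A B A≋B _       = tt
    vanishes-cong (suc m) A B A≋B (e , v) =
      trans (sym (eval-cong ζ A B A≋B)) e , vanishes-cong m (qD A) (qD B) (qD-cong A B A≋B) v

    vanishes-⊕ : ∀ m A B → Vanishes m A → Vanishes m B → Vanishes m (A ⊕ B)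
    vanishes-⊕ zero    A B _       _         = tt
    vanishes-⊕ (suc m) A B (e , v) (e' , v') =
      trans (eval-⊕ ζ A B) (trans (+-cong e e') (+-identityˡ 0#)) ,
      vanishes-cong m _ _ (λ i → sym (qD-⊕ A B i)) (vanishes-⊕ m (qD A) (qD B) v v')

    vanishes-down : ∀ m p → Vanishes (suc m) p → Vanishes m p
    vanishes-down zero    p _       = tt
    vanishes-down (suc m) p (e , v) = e , vanishes-down m (qD p) v

    -- Orders add under multiplication: by the Leibniz rule, the θ-derivative
    -- of a product is a sum of products of total order one less.
    vanishes-⊗ : ∀ m n p r → Vanishes m p → Vanishes n r → Vanishes (m Nat.+ n) (p ⊗ r)
    vanishes-⊗ zero zero p r _ _ = tt
    vanishes-⊗ zero (suc n) p r _ (e , v) =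
      trans (eval-⊗ ζ p r) (trans (*-congˡ e) (zeroʳ _)) ,
      vanishes-cong n _ _ (λ i → sym (leibniz p r i))
        (vanishes-⊕ n (qD p ⊗ r) (p ⊗ qD r)
          (vanishes-⊗ zero n (qD p) r tt (vanishes-down n r (e , v)))
          (vanishes-⊗ zero n p (qD r) tt v))
    vanishes-⊗ (suc m) n p r (e , v) w =
      trans (eval-⊗ ζ p r) (trans (*-congʳ e) (zeroˡ _)) ,
      vanishes-cong (m Nat.+ n) _ _ (λ i → sym (leibniz p r i))
        (vanishes-⊕ (m Nat.+ n) (qD p ⊗ r) (p ⊗ qD r)
          (vanishes-⊗ m n (qD p) r v w) (p-times-θr n r w))
      where
        p-times-θr : ∀ n r → Vanishes n r → Vanishes (m Nat.+ n) (p ⊗ qD r)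
        p-times-θr zero    r _        = vanishes-⊗ m zero p (qD r) (vanishes-down m p (e , v)) tt
        p-times-θr (suc n) r (_ , w') =
          ≡.subst (λ o → Vanishes o (p ⊗ qD r)) (≡.sym (ℕₚ.+-suc m n))
            (vanishes-⊗ (suc m) n p (qD r) (e , v) w')

    vanishes-⊗-any : ∀ m p r → Vanishes m p → Vanishes m (p ⊗ r)
    vanishes-⊗-any m p r v =
      ≡.subst (λ o → Vanishes o (p ⊗ r)) (ℕₚ.+-identityʳ m) (vanishes-⊗ m zero p r v tt)

    vanishes-⊗-root : ∀ m p r → Vanishes m p → eval r ζ ≈ 0# → Vanishes (suc m) (p ⊗ r)
    vanishes-⊗-root m p r v e =
      ≡.subst (λ o → Vanishes o (p ⊗ r)) (ℕₚ.+-comm m 1) (vanishes-⊗ m 1 p r v (e , tt))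

    vanishes-qD^ : ∀ l p → Vanishes (suc l) p → eval (qD^ l p) ζ ≈ 0#
    vanishes-qD^ zero    p (e , _) = e
    vanishes-qD^ (suc l) p (_ , v) =
      ≡.subst (λ X → eval X ζ ≈ 0#) (qD^-suc l p) (vanishes-qD^ l (qD p) v)

    module PeriodicProducts (P c : ℕ → Polynomial) (P-step : ∀ n → P (suc n) ≡ P n ⊗ c n)
                            (a k : ℕ) (1≤k : 1 ≤ k)
                            (roots : ∀ j → eval (c (a Nat.+ j Nat.* k)) ζ ≈ 0#) where

      order-mono : ∀ m {n n'} → n ≤′ n' → Vanishes m (P n) → Vanishes m (P n')
      order-mono m ≤′-refl               v = v
      order-mono m (≤′-step {n'} n≤′n') v =
        ≡.subst (Vanishes m) (≡.sym (P-step n')) (vanishes-⊗-any m _ (c n') (order-mono m n≤′n' v))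

      order-raise : ∀ m n → eval (c n) ζ ≈ 0# → Vanishes m (P n) → Vanishes (suc m) (P (suc n))
      order-raise m n e v = ≡.subst (Vanishes (suc m)) (≡.sym (P-step n)) (vanishes-⊗-root m (P n) (c n) v e)

      root-positions-increase : ∀ j → a Nat.+ j Nat.* k < a Nat.+ suc j Nat.* k
      root-positions-increase j = +-monoʳ-< a (m<n+m (j Nat.* k) 1≤k)

      periodic-order : ∀ j {n} → a Nat.+ j Nat.* k < n → Vanishes (suc j) (P n)
      periodic-order zero    lt =
        order-mono 1 (≤⇒≤′ lt) (order-raise 0 _ (roots 0) tt)
      periodic-order (suc j) lt =
        order-mono (suc (suc j)) (≤⇒≤′ lt)
          (order-raise (suc j) _ (roots (suc j)) (periodic-order j (root-positions-increase j)))

  eventually-constant : (x : ℕ → Carrier) (t : ℕ) → (∀ M → t ≤ M → x (suc M) ≈ x M) →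
    ∀ N M → t ≤ N → t ≤ M → x N ≈ x M
  eventually-constant x t step N M t≤N t≤M = trans (settled (≤⇒≤′ t≤N)) (sym (settled (≤⇒≤′ t≤M)))
    where
      settled : ∀ {N} → t ≤′ N → x N ≈ x t
      settled ≤′-refl         = refl
      settled (≤′-step t≤′N) = trans (step _ (≤′⇒≤ t≤′N)) (settled t≤′N)

  -- Partial sums S N = Σ_{n ≤ N} f n · P n with P as above: θ^l S N at ζ is
  -- the same for all N ≥ a + l k, since every later summand has order > l.
  module WeightedSums (ζ : Carrier) (P c : ℕ → Polynomial) (P-step : ∀ n → P (suc n) ≡ P n ⊗ c n)
                      (a k : ℕ) (1≤k : 1 ≤ k)
                      (roots : ∀ j → eval (c (a Nat.+ j Nat.* k)) ζ ≈ 0#)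
                      (f S : ℕ → Polynomial)
                      (S-step : ∀ N → S (suc N) ≡ S N ⊕ (f (suc N) ⊗ P (suc N))) where
    open Vanishing ζ
    open PeriodicProducts P c P-step a k 1≤k roots

    late-summand-invisible : ∀ l M → a Nat.+ l Nat.* k ≤ M →
      eval (qD^ l (f (suc M) ⊗ P (suc M))) ζ ≈ 0#
    late-summand-invisible l M le =
      vanishes-qD^ l _ (vanishes-⊗ zero (suc l) (f (suc M)) (P (suc M)) tt (periodic-order l (s≤s le)))

    sums-settle : ∀ l N M → a Nat.+ l Nat.* k ≤ N → a Nat.+ l Nat.* k ≤ M →
      eval (qD^ l (S N)) ζ ≈ eval (qD^ l (S M)) ζ
    sums-settle l = eventually-constant (λ N → eval (qD^ l (S N)) ζ) _ step
      where
        step : ∀ M → a Nat.+ l Nat.* k ≤ M → eval (qD^ l (S (suc M))) ζ ≈ eval (qD^ l (S M)) ζ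
        step M le = begin
          eval (qD^ l (S (suc M))) ζ                   ≡⟨ ≡.cong (λ X → eval (qD^ l X) ζ) (S-step M) ⟩
          eval (qD^ l (S M ⊕ T)) ζ
            ≈⟨ eval-cong ζ (qD^ l (S M ⊕ T)) (qD^ l (S M) ⊕ qD^ l T) (qD^-⊕ l (S M) T) ⟩
          eval (qD^ l (S M) ⊕ qD^ l T) ζ               ≈⟨ eval-⊕ ζ (qD^ l (S M)) (qD^ l T) ⟩
          eval (qD^ l (S M)) ζ + eval (qD^ l T) ζ      ≈⟨ +-congˡ (late-summand-invisible l M le) ⟩
          eval (qD^ l (S M)) ζ + 0#                    ≈⟨ +-identityʳ _ ⟩
          eval (qD^ l (S M)) ζ                         ∎
          where T = f (suc M) ⊗ P (suc M)

  -- Part (1): the factor 1 - q^(n+1) of (q;q)_n vanishes at ζ for n = (k-1) + j k,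
  -- so θ^l F(q;N) at ζ is the same for all N ≥ (l+1) k - 1.
  Fsum-settles : (f : ℕ → Polynomial) (k : ℕ) (ζ : Carrier) → 1 ≤ k → ζ ^ k ≈ 1# → ∀ l N M →
    suc l Nat.* k ≤ suc N → suc l Nat.* k ≤ suc M →
    eval (qD^ l (Fsum f N)) ζ ≈ eval (qD^ l (Fsum f M)) ζ
  Fsum-settles f k@(suc k') ζ 1≤k ζᵏ≈1 l N M le le' = F.sums-settle l N M (s≤s⁻¹ le) (s≤s⁻¹ le')
    where
      module F = WeightedSums ζ qq-poch (λ n → one-minus-qpow (suc n)) (λ _ → ≡.refl) k' k 1≤k
                   (λ j → eval-one-minus-qpow ζ (suc j Nat.* k) (root-pow ζ k (suc j) ζᵏ≈1))
                   f (Fsum f) (λ _ → ≡.refl)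

  -- Part (2), for odd k = 2m+1: the factor 1 - q^(2n+1) of (q;q²)_n vanishes at ζ
  -- for n = m + j k, so θ^l G(q;N) at ζ is the same for all N with 2N ≥ (2l+1) k.
  Gsum-settles : (g : ℕ → Polynomial) (m : ℕ) (ζ : Carrier) → ζ ^ suc (2 Nat.* m) ≈ 1# → ∀ l N M →
    suc (2 Nat.* l) Nat.* suc (2 Nat.* m) ≤ 2 Nat.* N → suc (2 Nat.* l) Nat.* suc (2 Nat.* m) ≤ 2 Nat.* M →
    eval (qD^ l (Gsum g N)) ζ ≈ eval (qD^ l (Gsum g M)) ζ
  Gsum-settles g m ζ ζᵏ≈1 l N M le le' =
    G.sums-settle l N M (odd-threshold m l N le) (odd-threshold m l M le')
    where
      k : ℕ
      k = suc (2 Nat.* m)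
      module G = WeightedSums ζ qq2-poch (λ n → one-minus-qpow (suc (2 Nat.* n))) (λ _ → ≡.refl) m k (s≤s z≤n)
                   (λ j → eval-one-minus-qpow ζ (suc (2 Nat.* (m Nat.+ j Nat.* k)))
                      (≡.subst (λ e → ζ ^ e ≈ 1#) (≡.sym (odd-exponent m j)) (root-pow ζ k (suc (2 Nat.* j)) ζᵏ≈1)))
                   g (Gsum g) (λ _ → ≡.refl)

lemma2p1 : ∀ {c ℓ' : Level} (R : CommutativeRing c ℓ') →
    let open CommutativeRing R in
    let open Poly R in
    (f g : ℕ → Polynomial) (k : ℕ) (ζ : Carrier) →
    1 ≤ k → ζ ^ k ≈ 1# → (ℓ : ℕ) →
    (∀ N M → suc ℓ Nat.* k ≤ suc N → suc ℓ Nat.* k ≤ suc M →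
      eval (qD^ ℓ (Fsum f N)) ζ ≈ eval (qD^ ℓ (Fsum f M)) ζ)
    ×
    ((∃ λ m → k ≡ suc (2 Nat.* m)) →
      ∀ N M → suc (2 Nat.* ℓ) Nat.* k ≤ 2 Nat.* N → suc (2 Nat.* ℓ) Nat.* k ≤ 2 Nat.* M →
      eval (qD^ ℓ (Gsum g N)) ζ ≈ eval (qD^ ℓ (Gsum g M)) ζ)
lemma2p1 R f g k ζ 1≤k ζᵏ≈1 l =
  Fsum-settles f k ζ 1≤k ζᵏ≈1 l , λ { (m , ≡.refl) → Gsum-settles g m ζ ζᵏ≈1 l }
  where open Theory R
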